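{- Let $n,k,\ell$ be integers with $n>2k$ and $k \geq \ell \geq 2$, and let $X=\{1,\ldots,n\}$. Suppose that $\mathcal F \subset \binom{X}{k}$ is a saturated intersecting family, and let $\mathcal B = \mathcal B(\mathcal F)$ be the family of inclusion-minimal sets in $\mathcal T(\mathcal F)$. Let $t := \min\{|B|\colon B \in \mathcal B\}$ and assume $t \geq 2$. Assume further that $\tau(\mathcal B^{(\le \ell)}) \geq 2$. Then $$|\mathcal B^{(\ell)}| \leq t \cdot \ell \cdot k^{\ell - 2}.$$
   Context: $\binom{X}{k}$ denotes the family of all $k$-subsets of $X$. A family $\mathcal F$ is intersecting if $F\cap F'\neq\emptyset$ for all $F,F'\in\mathcal F$. An intersecting family $\mathcal F \subset \binom{X}{k}$ is saturated if $\mathcal F \cup \{G\}$ is not intersecting for every $G \in \binom{X}{k}\setminus \mathcal F$. For $\mathcal G \subset 2^X$, $\mathcal T(\mathcal G) := \{T \subset X\colon |T| \leq k,\ T \cap G \neq \emptyset \text{ for all } G \in \mathcal G\}$. For a family $\mathcal G$, $\mathcal G^{(j)} := \{G \in \mathcal G\colon |G| = j\}$ and $\mathcal G^{(\le \ell)} := \bigcup_{i=1}^{\ell} \mathcal G^{(i)}$. The covering number of a family $\mathcal G$ is $\tau(\mathcal G) := \min\{|T|\colon T \cap G \neq \emptyset \text{ for all } G \in \mathcal G\}$. -}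

module Defs where

open import Data.Nat using (ℕ; _≤_; _<_; _^_; _*_; _∸_)
open import Data.Fin using (Fin)
open import Data.Fin.Subset using (Subset; _⊆_; _∩_; ∣_∣; Nonempty)
open import Data.List using (List; length)
open import Data.List.Relation.Unary.All using (All)
open import Data.List.Relation.Unary.Unique.Propositional using (Unique)
open import Data.Product using (_×_; ∃)
open import Relation.Nullary using (¬_)
open import Relation.Binary.PropositionalEquality using (_≡_)

Family : ℕ → Set₁
Family n = Subset n → Set

IsKUniform : ∀ {n} → ℕ → Family n → Set
IsKUniform k 𝓕 = ∀ F → 𝓕 F → ∣ F ∣ ≡ k

Intersecting : ∀ {n} → Family n → Set
Intersecting 𝓕 = ∀ F F′ → 𝓕 F → 𝓕 F′ → Nonempty (F ∩ F′)

Saturated : ∀ {n} → ℕ → Family n → Set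
Saturated k 𝓕 =
  IsKUniform k 𝓕 × Intersecting 𝓕 ×
  (∀ G → ∣ G ∣ ≡ k → ¬ 𝓕 G → ¬ (∀ F → 𝓕 F → Nonempty (G ∩ F)))

Transversals : ∀ {n} → ℕ → Family n → Family n
Transversals k 𝒢 T = ∣ T ∣ ≤ k × (∀ G → 𝒢 G → Nonempty (T ∩ G))

Minimal : ∀ {n} → Family n → Family n
Minimal 𝒜 B = 𝒜 B × (∀ A → 𝒜 A → A ⊆ B → A ≡ B)

BFam : ∀ {n} → ℕ → Family n → Family n
BFam k 𝓕 = Minimal (Transversals k 𝓕)

Layer : ∀ {n} → Family n → ℕ → Family n
Layer 𝒢 j G = 𝒢 G × ∣ G ∣ ≡ j

UpTo : ∀ {n} → Family n → ℕ → Family n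
UpTo 𝒢 ℓ G = 𝒢 G × 1 ≤ ∣ G ∣ × ∣ G ∣ ≤ ℓ

Covers : ∀ {n} → Subset n → Family n → Set
Covers T 𝒢 = ∀ G → 𝒢 G → Nonempty (T ∩ G)

CoverNumberAtLeast : ∀ {n} → Family n → ℕ → Set
CoverNumberAtLeast 𝒢 m = ∀ T → ∣ T ∣ < m → ¬ Covers T 𝒢

IsMinSize : ∀ {n} → Family n → ℕ → Set
IsMinSize 𝒜 t = ∃ (λ B → 𝒜 B × ∣ B ∣ ≡ t) × (∀ B → 𝒜 B → t ≤ ∣ B ∣)

CardAtMost : ∀ {n} → Family n → ℕ → Set
CardAtMost {n} 𝒜 m = ∀ (xs : List (Subset n)) → Unique xs → All 𝒜 xs → length xs ≤ m

-- Since 𝓕 is saturated and n > 2k, the minimal transversals 𝓑 pairwise intersect: a k-set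
-- containing B and avoiding B′ would be forced into 𝓕. A proper subset S of some B ∈ 𝓑 is
-- not a transversal, so some F ∈ 𝓕 misses S; every ℓ-set of 𝓑 above S then contains one of
-- the k points of F, so at most k^(ℓ − |S|) members of 𝓑^(ℓ) contain S. Finally every
-- B ∈ 𝓑^(ℓ) meets a fixed B₀ ∈ 𝓑 of size t in some x, and since {x} does not cover
-- 𝓑^(≤ℓ) there is G ∈ 𝓑^(≤ℓ) with x ∉ G; B also meets G in some y ≠ x, and at most
-- k^(ℓ−2) members contain {x, y}.
module Submission where

open import Defs
open import Data.Nat using (ℕ; zero; suc; _+_; _*_; _^_; _∸_; _≤_; _<_; z≤n; s≤s; _≤?_; >-nonZero)
open import Data.Nat.Properties
open import Data.Bool using (true; false)
open import Data.Fin using (Fin; zero; suc)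
open import Data.Fin.Subset using (Subset; _∈_; _∉_; _⊆_; _∩_; _∪_; ∣_∣; Nonempty; Empty; ⁅_⁆; ∁; _-_)
open import Data.Fin.Subset.Properties
open import Data.Vec using ([]; _∷_; here; there)
open import Data.List using (List; []; _∷_; length; filter; map)
open import Data.List.Properties using (length-map)
open import Data.List.Relation.Unary.All using (All; []; _∷_)
import Data.List.Relation.Unary.All as All
import Data.List.Relation.Unary.All.Properties as All
open import Data.List.Relation.Unary.Any using (Any; here; there)
import Data.List.Relation.Unary.Any as Any
open import Data.List.Relation.Unary.Unique.Propositional using (Unique)
import Data.List.Relation.Unary.Unique.Propositional.Properties as Unique
open import Data.List.Relation.Unary.AllPairs using (_∷_)
open import Data.List.Membership.Propositional using (lose) renaming (_∈_ to _∈ₗ_)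
open import Data.List.Membership.Propositional.Properties using (∈-map⁺; ∈-map⁻)
open import Data.Product using (_×_; ∃; _,_)
open import Data.Sum using (inj₁; inj₂)
open import Function using (_∘_; id)
open import Relation.Nullary using (¬_; yes; no; contradiction; ¬¬-map)
open import Relation.Nullary.Decidable using (decidable-stable)
open import Relation.Unary using (Pred; Decidable)
open import Relation.Unary.Properties using (∁?)
open import Relation.Binary.PropositionalEquality using (_≡_; refl; sym; trans; cong; subst)

length-filter-∁ : ∀ {a p} {A : Set a} {P : Pred A p} (P? : Decidable P) (xs : List A) →
                  length (filter P? xs) + length (filter (∁? P?) xs) ≡ length xs
length-filter-∁ P? [] = refl
length-filter-∁ P? (x ∷ xs) with P? x
... | yes _ = cong suc (length-filter-∁ P? xs)
... | no _  = trans (+-suc _ _) (cong suc (length-filter-∁ P? xs))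

private
  variable
    n : ℕ

elements : Subset n → List (Fin n)
elements []          = []
elements (true ∷ p)  = zero ∷ map suc (elements p)
elements (false ∷ p) = map suc (elements p)

length-elements : ∀ (p : Subset n) → length (elements p) ≡ ∣ p ∣
length-elements []          = refl
length-elements (true ∷ p)  = cong suc (trans (length-map suc (elements p)) (length-elements p))
length-elements (false ∷ p) = trans (length-map suc (elements p)) (length-elements p)

∈-elements⁺ : ∀ {x} {p : Subset n} → x ∈ p → x ∈ₗ elements p
∈-elements⁺ {p = true ∷ p}  here      = here refl
∈-elements⁺ {p = true ∷ p}  (there x∈p) = there (∈-map⁺ suc (∈-elements⁺ x∈p))
∈-elements⁺ {p = false ∷ p} (there x∈p) = ∈-map⁺ suc (∈-elements⁺ x∈p)

∈-elements⁻ : ∀ {x} (p : Subset n) → x ∈ₗ elements p → x ∈ p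
∈-elements⁻ (true ∷ p) (here refl) = here
∈-elements⁻ (true ∷ p) (there x∈) with ∈-map⁻ suc x∈
... | _ , y∈ , refl = there (∈-elements⁻ p y∈)
∈-elements⁻ (false ∷ p) x∈ with ∈-map⁻ suc x∈
... | _ , y∈ , refl = there (∈-elements⁻ p y∈)

x∈p⇒⁅x⁆⊆p : ∀ {x} {p : Subset n} → x ∈ p → ⁅ x ⁆ ⊆ p
x∈p⇒⁅x⁆⊆p {x = x} x∈p y∈⁅x⁆ = subst (_∈ _) (sym (x∈⁅y⁆⇒x≡y x y∈⁅x⁆)) x∈p

p⊆q∧x∈q⇒p∪⁅x⁆⊆q : ∀ {x} {p q : Subset n} → p ⊆ q → x ∈ q → p ∪ ⁅ x ⁆ ⊆ q
p⊆q∧x∈q⇒p∪⁅x⁆⊆q {x = x} {p = p} p⊆q x∈q y∈ with x∈p∪q⁻ p ⁅ x ⁆ y∈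
... | inj₁ y∈p    = p⊆q y∈p
... | inj₂ y∈⁅x⁆ = x∈p⇒⁅x⁆⊆p x∈q y∈⁅x⁆

x∉p⇒∣p∣<∣p∪⁅x⁆∣ : ∀ {x} (p : Subset n) → x ∉ p → ∣ p ∣ < ∣ p ∪ ⁅ x ⁆ ∣
x∉p⇒∣p∣<∣p∪⁅x⁆∣ {x = x} p x∉p = begin-strict
  ∣ p ∣                 ≤⟨ p⊆q⇒∣p∣≤∣q∣ p⊆p∪⁅x⁆-x ⟩
  ∣ (p ∪ ⁅ x ⁆) - x ∣  <⟨ x∈p⇒∣p-x∣<∣p∣ (q⊆p∪q p ⁅ x ⁆ (x∈⁅x⁆ x)) ⟩
  ∣ p ∪ ⁅ x ⁆ ∣        ∎
  where
  open ≤-Reasoning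
  p⊆p∪⁅x⁆-x : p ⊆ (p ∪ ⁅ x ⁆) - x
  p⊆p∪⁅x⁆-x y∈p = x∈p∧x≢y⇒x∈p-y (p⊆p∪q ⁅ x ⁆ y∈p) (λ { refl → x∉p y∈p })

p⊆q∧∣q∣≤∣p∣⇒p≡q : ∀ {p q : Subset n} → p ⊆ q → ∣ q ∣ ≤ ∣ p ∣ → p ≡ q
p⊆q∧∣q∣≤∣p∣⇒p≡q {p = []}        {q = []}        _   _ = refl
p⊆q∧∣q∣≤∣p∣⇒p≡q {p = true ∷ p}  {q = true ∷ q}  p⊆q (s≤s ∣q∣≤∣p∣) =
  cong (true ∷_) (p⊆q∧∣q∣≤∣p∣⇒p≡q (drop-∷-⊆ p⊆q) ∣q∣≤∣p∣)
p⊆q∧∣q∣≤∣p∣⇒p≡q {p = false ∷ p} {q = false ∷ q} p⊆q ∣q∣≤∣p∣ =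
  cong (false ∷_) (p⊆q∧∣q∣≤∣p∣⇒p≡q (drop-∷-⊆ p⊆q) ∣q∣≤∣p∣)
p⊆q∧∣q∣≤∣p∣⇒p≡q {p = false ∷ p} {q = true ∷ q}  p⊆q ∣q∣<∣p∣ =
  contradiction (≤-trans ∣q∣<∣p∣ (p⊆q⇒∣p∣≤∣q∣ (drop-∷-⊆ p⊆q))) (<-irrefl refl)
p⊆q∧∣q∣≤∣p∣⇒p≡q {p = true ∷ p}  {q = false ∷ q} p⊆q _ with p⊆q here
... | ()

⊆-interpolate : ∀ (p q : Subset n) {m} → p ⊆ q → ∣ p ∣ ≤ m → m ≤ ∣ q ∣ →
                ∃ λ r → p ⊆ r × r ⊆ q × ∣ r ∣ ≡ m
⊆-interpolate [] [] {zero} _ _ _ = [] , id , id , refl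
⊆-interpolate (true ∷ p) (false ∷ q) p⊆q _ _ with p⊆q here
... | ()
⊆-interpolate (true ∷ p) (true ∷ q) {suc m} p⊆q (s≤s ∣p∣≤m) (s≤s m≤∣q∣)
  with r , p⊆r , r⊆q , ∣r∣≡m ← ⊆-interpolate p q (drop-∷-⊆ p⊆q) ∣p∣≤m m≤∣q∣
  = true ∷ r , s⊆s p⊆r , s⊆s r⊆q , cong suc ∣r∣≡m
⊆-interpolate (false ∷ p) (false ∷ q) p⊆q ∣p∣≤m m≤∣q∣
  with r , p⊆r , r⊆q , ∣r∣≡m ← ⊆-interpolate p q (drop-∷-⊆ p⊆q) ∣p∣≤m m≤∣q∣
  = false ∷ r , s⊆s p⊆r , s⊆s r⊆q , ∣r∣≡m
⊆-interpolate (false ∷ p) (true ∷ q) {m} p⊆q ∣p∣≤m m≤1+∣q∣ with m ≤? ∣ q ∣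
... | yes m≤∣q∣
  with r , p⊆r , r⊆q , ∣r∣≡m ← ⊆-interpolate p q (drop-∷-⊆ p⊆q) ∣p∣≤m m≤∣q∣
  = false ∷ r , s⊆s p⊆r , out⊆ r⊆q , ∣r∣≡m
... | no m≰∣q∣ = true ∷ q , out⊆ (drop-∷-⊆ p⊆q) , id , ≤-antisym (≰⇒> m≰∣q∣) m≤1+∣q∣

Empty-∩⇒⊆∁ : ∀ {p q : Subset n} → Empty (p ∩ q) → p ⊆ ∁ q
Empty-∩⇒⊆∁ p∩q≡∅ x∈p = x∉p⇒x∈∁p (λ x∈q → p∩q≡∅ (_ , x∈p∩q⁺ (x∈p , x∈q)))

Empty-∩⇒∉ : ∀ {p q : Subset n} {x} → Empty (p ∩ q) → x ∈ q → x ∉ p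
Empty-∩⇒∉ p∩q≡∅ x∈q x∈p = p∩q≡∅ (_ , x∈p∩q⁺ (x∈p , x∈q))

private
  variable
    𝒜 𝒜′ : Family n
    c m : ℕ

cardAtMost-weaken : (∀ {A} → 𝒜′ A → 𝒜 A) → c ≤ m → CardAtMost 𝒜 c → CardAtMost 𝒜′ m
cardAtMost-weaken 𝒜′⊆𝒜 c≤m bound xs unique xs∈𝒜′ = ≤-trans (bound xs unique (All.map 𝒜′⊆𝒜 xs∈𝒜′)) c≤m

cardAtMost-stable : ¬ ¬ CardAtMost 𝒜 m → CardAtMost 𝒜 m
cardAtMost-stable ¬¬bound xs unique xs∈𝒜 =
  decidable-stable (_ ≤? _) (λ ¬fits → ¬¬bound (λ bound → ¬fits (bound xs unique xs∈𝒜)))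

cardAtMost-inhabited : (∀ {A} → 𝒜 A → CardAtMost 𝒜 m) → CardAtMost 𝒜 m
cardAtMost-inhabited bound []       _      _            = z≤n
cardAtMost-inhabited bound (A ∷ xs) unique xs∈𝒜@(A∈𝒜 ∷ _) = bound A∈𝒜 (A ∷ xs) unique xs∈𝒜

cardAtMost-tight-supersets : ∀ (p : Subset n) → CardAtMost (λ q → p ⊆ q × ∣ q ∣ ≤ ∣ p ∣) 1
cardAtMost-tight-supersets p []          _                _                   = z≤n
cardAtMost-tight-supersets p (_ ∷ [])    _                _                   = s≤s z≤n
cardAtMost-tight-supersets p (_ ∷ _ ∷ _) ((q≢q′ ∷ _) ∷ _) (tight ∷ tight′ ∷ _) =
  contradiction (trans (sym (equal tight)) (equal tight′)) q≢q′
  where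
  equal : ∀ {q} → p ⊆ q × ∣ q ∣ ≤ ∣ p ∣ → p ≡ q
  equal (p⊆q , ∣q∣≤∣p∣) = p⊆q∧∣q∣≤∣p∣⇒p≡q p⊆q ∣q∣≤∣p∣

cardAtMost-⋃ : ∀ (ys : List (Fin n)) → (∀ {A} → 𝒜 A → Any (_∈ A) ys) →
               (∀ {y} → y ∈ₗ ys → CardAtMost (λ A → 𝒜 A × y ∈ A) c) →
               CardAtMost 𝒜 (length ys * c)
cardAtMost-⋃ [] covered _ [] _ _ = z≤n
cardAtMost-⋃ [] covered _ (_ ∷ _) _ (A∈𝒜 ∷ _) with () ← covered A∈𝒜
cardAtMost-⋃ {𝒜 = 𝒜} {c = c} (y ∷ ys) covered bound xs unique xs∈𝒜 = begin
  length xs                                      ≡⟨ length-filter-∁ ∋y? xs ⟨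
  length (filter ∋y? xs) + length (filter ∌y? xs) ≤⟨ +-mono-≤ with-y without-y ⟩
  c + length ys * c                              ∎
  where
  open ≤-Reasoning
  ∋y? = λ A → y ∈? A
  ∌y? = ∁? ∋y?
  with-y : length (filter ∋y? xs) ≤ c
  with-y = bound (here refl) _ (Unique.filter⁺ ∋y? unique)
             (All.zip (All.filter⁺ ∋y? xs∈𝒜 , All.all-filter ∋y? xs))
  without-y : length (filter ∌y? xs) ≤ length ys * c
  without-y = cardAtMost-⋃ {𝒜 = λ A → 𝒜 A × y ∉ A} ys
    (λ (A∈𝒜 , y∉A) → Any.tail y∉A (covered A∈𝒜))
    (λ y′∈ys → cardAtMost-weaken (λ ((A∈𝒜 , _) , y′∈A) → A∈𝒜 , y′∈A) ≤-refl (bound (there y′∈ys)))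
    _ (Unique.filter⁺ ∌y? unique) (All.zip (All.filter⁺ ∌y? xs∈𝒜 , All.all-filter ∌y? xs))

cardAtMost-hitting : ∀ (F : Subset n) → (∀ {A} → 𝒜 A → Nonempty (A ∩ F)) →
                     (∀ {y} → y ∈ F → CardAtMost (λ A → 𝒜 A × y ∈ A) c) →
                     CardAtMost 𝒜 (∣ F ∣ * c)
cardAtMost-hitting {𝒜 = 𝒜} {c = c} F hits bound =
  subst (λ m → CardAtMost 𝒜 (m * c)) (length-elements F)
    (cardAtMost-⋃ (elements F) covered (bound ∘ ∈-elements⁻ F))
  where
  covered : ∀ {A} → 𝒜 A → Any (_∈ A) (elements F)
  covered {A} A∈𝒜 with x , x∈A∩F ← hits A∈𝒜 with x∈A , x∈F ← x∈p∩q⁻ A F x∈A∩F =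
    lose (∈-elements⁺ x∈F) x∈A

uncovered-member : ∀ {T : Subset n} {𝒢 : Family n} → ¬ Covers T 𝒢 → ¬ ¬ ∃ λ G → 𝒢 G × Empty (T ∩ G)
uncovered-member ¬covers ¬uncovered =
  ¬covers (λ G G∈𝒢 → decidable-stable (nonempty? _) (λ T∩G≡∅ → ¬uncovered (G , G∈𝒢 , T∩G≡∅)))

covers-⊆ : ∀ {T T′ : Subset n} {𝒢 : Family n} → T ⊆ T′ → Covers T 𝒢 → Covers T′ 𝒢
covers-⊆ {T = T} T⊆T′ covers G G∈𝒢 with x , x∈T∩G ← covers G G∈𝒢 with x∈T , x∈G ← x∈p∩q⁻ T G x∈T∩G =
  x , x∈p∩q⁺ (T⊆T′ x∈T , x∈G)

covers-avoids : ∀ {T G : Subset n} {𝒢 : Family n} → Covers T 𝒢 → G ⊆ ∁ T → ¬ 𝒢 G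
covers-avoids {T = T} {G} covers G⊆∁T G∈𝒢 with x , x∈T∩G ← covers G G∈𝒢 with x∈T , x∈G ← x∈p∩q⁻ T G x∈T∩G =
  x∈∁p⇒x∉p (G⊆∁T x∈G) x∈T

module _ {n k : ℕ} {𝓕 : Family n} where

  private
    𝓑 : Family n
    𝓑 = BFam k 𝓕

  proper-subset-not-cover : ∀ {S B} → 𝓑 B → S ⊆ B → ∣ S ∣ < ∣ B ∣ → ¬ Covers S 𝓕
  proper-subset-not-cover ((∣B∣≤k , _) , minimal) S⊆B ∣S∣<∣B∣ S-covers =
    <-irrefl (cong ∣_∣ S≡B) ∣S∣<∣B∣
    where
    S≡B = minimal _ (≤-trans (p⊆q⇒∣p∣≤∣q∣ S⊆B) ∣B∣≤k , S-covers) S⊆B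

  BFam-intersecting : 2 * k < n → Saturated k 𝓕 → Intersecting 𝓑
  BFam-intersecting 2k<n (_ , _ , maximal) B B′ ((∣B∣≤k , B-covers) , _) ((∣B′∣≤k , B′-covers) , _) =
    decidable-stable (nonempty? _) disjoint-absurd
    where
    open ≤-Reasoning
    k≤∣∁B′∣ : k ≤ ∣ ∁ B′ ∣
    k≤∣∁B′∣ = begin
      k           ≤⟨ m+n≤o⇒m≤o∸n k (subst (_≤ n) (cong (k +_) (+-identityʳ k)) (<⇒≤ 2k<n)) ⟩
      n ∸ k       ≤⟨ ∸-monoʳ-≤ n ∣B′∣≤k ⟩
      n ∸ ∣ B′ ∣  ≡⟨ ∣∁p∣≡n∸∣p∣ B′ ⟨
      ∣ ∁ B′ ∣    ∎
    disjoint-absurd : ¬ Empty (B ∩ B′)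
    disjoint-absurd B∩B′≡∅
      with G , B⊆G , G⊆∁B′ , ∣G∣≡k ← ⊆-interpolate B (∁ B′) (Empty-∩⇒⊆∁ B∩B′≡∅) ∣B∣≤k k≤∣∁B′∣ =
      maximal G ∣G∣≡k (covers-avoids B′-covers G⊆∁B′) (covers-⊆ B⊆G B-covers)

  BFam-layer-supersets : IsKUniform k 𝓕 → 1 ≤ k → ∀ {ℓ} j (S : Subset n) → ℓ ≤ ∣ S ∣ + j →
                         CardAtMost (λ B → Layer 𝓑 ℓ B × S ⊆ B) (k ^ j)
  BFam-layer-supersets uniform 1≤k {ℓ} j S ℓ≤∣S∣+j with ℓ ≤? ∣ S ∣
  ... | yes ℓ≤∣S∣ =
    cardAtMost-weaken (λ ((_ , ∣B∣≡ℓ) , S⊆B) → S⊆B , ≤-trans (≤-reflexive ∣B∣≡ℓ) ℓ≤∣S∣)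
      (m^n>0 k {{>-nonZero 1≤k}} j) (cardAtMost-tight-supersets S)
  BFam-layer-supersets uniform 1≤k {ℓ} zero S ℓ≤∣S∣+0 | no ℓ≰∣S∣ =
    contradiction (subst (ℓ ≤_) (+-identityʳ ∣ S ∣) ℓ≤∣S∣+0) ℓ≰∣S∣
  BFam-layer-supersets uniform 1≤k {ℓ} (suc j) S ℓ≤∣S∣+1+j | no ℓ≰∣S∣ =
    cardAtMost-inhabited λ { ((B∈𝓑 , ∣B∣≡ℓ) , S⊆B) →
      cardAtMost-stable (¬¬-map branch (uncovered-member (proper-subset-not-cover B∈𝓑 S⊆B
        (subst (∣ S ∣ <_) (sym ∣B∣≡ℓ) (≰⇒> ℓ≰∣S∣))))) }
    where
    branch : (∃ λ F → 𝓕 F × Empty (S ∩ F)) → CardAtMost (λ B → Layer 𝓑 ℓ B × S ⊆ B) (k ^ suc j)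
    branch (F , F∈𝓕 , S∩F≡∅) =
      subst (λ m → CardAtMost (λ B → Layer 𝓑 ℓ B × S ⊆ B) (m * k ^ j)) (uniform F F∈𝓕)
        (cardAtMost-hitting F (λ ((((_ , B-covers) , _) , _) , _) → B-covers F F∈𝓕)
          λ {y} y∈F → cardAtMost-weaken
            (λ ((B∈𝓑ℓ , S⊆B) , y∈B) → B∈𝓑ℓ , p⊆q∧x∈q⇒p∪⁅x⁆⊆q S⊆B y∈B) ≤-refl
            (BFam-layer-supersets uniform 1≤k j (S ∪ ⁅ y ⁆) (begin
              ℓ                    ≤⟨ ℓ≤∣S∣+1+j ⟩
              ∣ S ∣ + suc j        ≡⟨ +-suc ∣ S ∣ j ⟩
              suc ∣ S ∣ + j        ≤⟨ +-monoˡ-≤ j (x∉p⇒∣p∣<∣p∪⁅x⁆∣ S (Empty-∩⇒∉ S∩F≡∅ y∈F)) ⟩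
              ∣ S ∪ ⁅ y ⁆ ∣ + j   ∎)))
      where open ≤-Reasoning

  BFam-layer-through : IsKUniform k 𝓕 → Intersecting 𝓑 → 1 ≤ k → ∀ {ℓ} →
                       CoverNumberAtLeast (UpTo 𝓑 ℓ) 2 → ∀ x →
                       CardAtMost (λ B → Layer 𝓑 ℓ B × x ∈ B) (ℓ * k ^ (ℓ ∸ 2))
  BFam-layer-through uniform intersecting 1≤k {ℓ} τ≥2 x =
    cardAtMost-stable (¬¬-map branch (uncovered-member (τ≥2 ⁅ x ⁆ (≤-reflexive (cong suc (∣⁅x⁆∣≡1 x))))))
    where
    branch : (∃ λ G → UpTo 𝓑 ℓ G × Empty (⁅ x ⁆ ∩ G)) →
             CardAtMost (λ B → Layer 𝓑 ℓ B × x ∈ B) (ℓ * k ^ (ℓ ∸ 2))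
    branch (G , (G∈𝓑 , _ , ∣G∣≤ℓ) , ⁅x⁆∩G≡∅) =
      cardAtMost-weaken id (*-monoˡ-≤ (k ^ (ℓ ∸ 2)) ∣G∣≤ℓ)
        (cardAtMost-hitting G (λ ((B∈𝓑 , _) , _) → intersecting _ _ B∈𝓑 G∈𝓑)
          λ {y} y∈G → cardAtMost-weaken
            (λ ((B∈𝓑ℓ , x∈B) , y∈B) → B∈𝓑ℓ , p⊆q∧x∈q⇒p∪⁅x⁆⊆q (x∈p⇒⁅x⁆⊆p x∈B) y∈B) ≤-refl
            (BFam-layer-supersets uniform 1≤k (ℓ ∸ 2) (⁅ x ⁆ ∪ ⁅ y ⁆) (begin
              ℓ                           ≤⟨ m≤n+m∸n ℓ 2 ⟩
              2 + (ℓ ∸ 2)                 ≡⟨ cong (λ m → suc m + (ℓ ∸ 2)) (∣⁅x⁆∣≡1 x) ⟨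
              suc ∣ ⁅ x ⁆ ∣ + (ℓ ∸ 2)     ≤⟨ +-monoˡ-≤ (ℓ ∸ 2) (x∉p⇒∣p∣<∣p∪⁅x⁆∣ ⁅ x ⁆ (Empty-∩⇒∉ ⁅x⁆∩G≡∅ y∈G)) ⟩
              ∣ ⁅ x ⁆ ∪ ⁅ y ⁆ ∣ + (ℓ ∸ 2)  ∎)))
      where open ≤-Reasoning

lemma2p3 : (n k ℓ : ℕ) → 2 * k < n → ℓ ≤ k → 2 ≤ ℓ →
    (𝓕 : Family n) → Saturated k 𝓕 →
    (t : ℕ) → IsMinSize (BFam k 𝓕) t → 2 ≤ t →
    CoverNumberAtLeast (UpTo (BFam k 𝓕) ℓ) 2 →
    CardAtMost (Layer (BFam k 𝓕) ℓ) (t * ℓ * k ^ (ℓ ∸ 2))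
lemma2p3 n k ℓ 2k<n ℓ≤k 2≤ℓ 𝓕 saturated@(uniform , _) t ((B₀ , B₀∈𝓑 , ∣B₀∣≡t) , _) _ τ≥2 =
  subst (CardAtMost (Layer (BFam k 𝓕) ℓ)) ∣B₀∣*[ℓ*K]≡t*ℓ*K
    (cardAtMost-hitting B₀ (λ (B∈𝓑 , _) → intersecting _ _ B∈𝓑 B₀∈𝓑)
      (λ {x} _ → BFam-layer-through uniform intersecting 1≤k τ≥2 x))
  where
  K = k ^ (ℓ ∸ 2)
  intersecting : Intersecting (BFam k 𝓕)
  intersecting = BFam-intersecting 2k<n saturated
  1≤k : 1 ≤ k
  1≤k = ≤-trans (≤-trans (s≤s z≤n) 2≤ℓ) ℓ≤k
  ∣B₀∣*[ℓ*K]≡t*ℓ*K : ∣ B₀ ∣ * (ℓ * K) ≡ t * ℓ * K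
  ∣B₀∣*[ℓ*K]≡t*ℓ*K = trans (cong (_* (ℓ * K)) ∣B₀∣≡t) (sym (*-assoc t ℓ K))
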